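{- Let $G$ be a finite tree with a proper edge coloring $\kappa:E(G)\to[k]$. If $\mathfrak{G}_\kappa$ is a generalized toggle group, then for every path in $G$ (with distinct vertices) having at least two edges, the word obtained by reading the edge colors along the path is a toggle word.
   Context: A proper edge coloring of $G$ on $k$ colors is a surjective map $\kappa:E(G)\to[k]$ such that edges sharing a vertex receive different colors. For $a\in[k]$, $\tau_a\in S_{V(G)}$ is the product of the transpositions $(i,j)$ over all edges $\{i,j\}$ colored $a$, and $\mathfrak{G}_\kappa\le S_{V(G)}$ is generated by $\tau_1,\dots,\tau_k$. Toggles: for a finite set $E$ and $L\subseteq 2^E$, $t_e$ ($e\in E$) is the permutation of $L$ with $t_e(X)=X\cup\{e\}$ if $e\notin X$ and $X\cup\{e\}\in L$, $t_e(X)=X\setminus\{e\}$ if $e\in X$ and $X\setminus\{e\}\in L$, and $t_e(X)=X$ otherwise. "$\mathfrak{G}_\kappa$ is a generalized toggle group" means: there exist a finite set $E$, $L\subseteq 2^E$, a bijection $\varphi:V(G)\to L$ and an injective map $c:[k]\to E$ such that for all distinct $u,v\in V(G)$ and $a\in[k]$, $\{u,v\}$ is an edge colored $a$ iff the symmetric difference of $\varphi(u)$ and $\varphi(v)$ is $\{c(a)\}$, and every $e\in E$ with $t_e\neq\mathrm{id}$ is in the image of $c$. A word $w\in[k]^\ell$ with $\ell\ge 2$ is a toggle word if every contiguous subword of $w$ of length at least $2$ has at least two distinct letters each occurring an odd number of times in that subword. -}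

module Defs where

open import Data.Nat using (ℕ; suc; _≤_; _%_)
open import Data.Fin using (Fin; _≟_)
open import Data.Fin.Subset using (Subset; ⁅_⁆)
open import Data.Bool using (Bool; _xor_)
open import Data.Maybe using (Maybe; just; nothing)
open import Data.List using (List; []; _∷_; _++_; length; filter)
open import Data.List.Relation.Unary.Unique.Propositional using (Unique)
open import Data.Vec using (zipWith)
open import Data.Product using (Σ; ∃; ∃-syntax; _×_; _,_)
open import Relation.Binary.PropositionalEquality using (_≡_; _≢_)
open import Relation.Nullary using (¬_)
open import Function.Definitions using (Injective)

-- An edge-coloured simple graph on vertex set Fin n with colours Fin k is
-- encoded by  col : Fin n → Fin n → Maybe (Fin k) :
-- {u,v} is an edge coloured a  iff  col u v ≡ just a ; non-edges map to nothing.

IsSimple : ∀ {n k} → (Fin n → Fin n → Maybe (Fin k)) → Set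
IsSimple col = (∀ u v → col u v ≡ col v u) × (∀ v → col v v ≡ nothing)

IsProperEdgeColoring : ∀ {n k} → (Fin n → Fin n → Maybe (Fin k)) → Set
IsProperEdgeColoring {n} {k} col =
  (∀ (a : Fin k) → ∃[ u ] ∃[ v ] col u v ≡ just a)
  × (∀ (u v w : Fin n) (a : Fin k) → col u v ≡ just a → col u w ≡ just a → v ≡ w)

data Walk {n k} (col : Fin n → Fin n → Maybe (Fin k))
     : Fin n → Fin n → List (Fin n) → List (Fin k) → Set where
  nil  : ∀ {v} → Walk col v v (v ∷ []) []
  cons : ∀ {u v w vs as} {a : Fin k} → col u v ≡ just a →
         Walk col v w vs as → Walk col u w (u ∷ vs) (a ∷ as)

Path : ∀ {n k} → (Fin n → Fin n → Maybe (Fin k)) →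
       Fin n → Fin n → List (Fin n) → List (Fin k) → Set
Path col u w vs as = Walk col u w vs as × Unique vs

Connected : ∀ {n k} → (Fin n → Fin n → Maybe (Fin k)) → Set
Connected col = ∀ u v → ∃[ vs ] ∃[ as ] Walk col u v vs as

-- a cycle: a path with at least two edges u … v plus an edge {v,u}
Acyclic : ∀ {n k} → (Fin n → Fin n → Maybe (Fin k)) → Set
Acyclic col = ∀ u v vs as b → Path col u v vs as → 2 ≤ length as →
              ¬ (col v u ≡ just b)

IsTree : ∀ {n k} → (Fin n → Fin n → Maybe (Fin k)) → Set
IsTree col = IsSimple col × Connected col × Acyclic col

_△_ : ∀ {m} → Subset m → Subset m → Subset m
X △ Y = zipWith _xor_ X Y

-- Generalized toggle group, with E = Fin m, L = image of φ (φ : V → L is a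
-- bijection iff φ : V → 2^E is injective with L its image).
-- t_e ≠ id on L  iff  some X ∈ L has X △ {e} ∈ L.
IsGeneralizedToggleGroup : ∀ {n k} → (Fin n → Fin n → Maybe (Fin k)) → Set
IsGeneralizedToggleGroup {n} {k} col =
  ∃[ m ] Σ (Fin n → Subset m) λ φ → Σ (Fin k → Fin m) λ c →
    Injective _≡_ _≡_ φ × Injective _≡_ _≡_ c
    × (∀ (u v : Fin n) (a : Fin k) → u ≢ v →
         (col u v ≡ just a → φ u △ φ v ≡ ⁅ c a ⁆)
         × (φ u △ φ v ≡ ⁅ c a ⁆ → col u v ≡ just a))
    × (∀ (e : Fin m) → (∃[ u ] ∃[ v ] φ v ≡ φ u △ ⁅ e ⁆) → ∃[ a ] c a ≡ e)

count : ∀ {k} → Fin k → List (Fin k) → ℕ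
count a ys = length (filter (_≟ a) ys)

Odd : ℕ → Set
Odd x = x % 2 ≡ 1

IsToggleWord : ∀ {k} → List (Fin k) → Set
IsToggleWord w = 2 ≤ length w ×
  (∀ xs ys zs → w ≡ xs ++ ys ++ zs → 2 ≤ length ys →
     ∃[ a ] ∃[ b ] a ≢ b × Odd (count a ys) × Odd (count b ys))

{-# OPTIONS --safe #-}
-- Identify each vertex v with its set φ v ⊆ E. Along a path from x to y with colour word ys,
-- φ x △ φ y is the set of c a over the letters a occurring an odd number of times in ys.
-- If no letter is odd then φ x ≡ φ y, contradicting injectivity of φ. If exactly one letter a
-- is odd then φ x and φ y differ in c a alone, so {x , y} is an edge coloured a, which closes
-- a cycle with the path.
module Submission where

open import Defs
open import Data.Nat using (ℕ; zero; suc; _≤_; _%_; _≟_)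
open import Data.Nat.Properties using (<⇒≤)
open import Data.Fin using (Fin)
import Data.Fin.Properties as Fin
open import Data.Fin.Subset using (Subset; ⁅_⁆; ⊥)
open import Data.Fin.Subset.Properties using (x∈⁅x⁆; x≢y⇒x∉⁅y⁆)
open import Data.Bool using (Bool; true; false; not; _xor_; if_then_else_)
open import Data.Bool.Properties using (xor-assoc; xor-identityˡ; xor-identityʳ; xor-same; not-involutive; ¬-not)
open import Data.Maybe using (Maybe; just; nothing)
open import Data.List using (List; []; _∷_; _++_; length; foldr; take; drop)
open import Data.List.Relation.Unary.All as All using (All)
open import Data.List.Relation.Unary.Any using (here; there)
open import Data.List.Relation.Unary.AllPairs using (_∷_)
open import Data.List.Relation.Unary.Unique.Propositional.Properties using (take⁺; drop⁺)
open import Data.List.Membership.Propositional using (_∈_)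
open import Data.Vec using (Vec; lookup; tabulate)
open import Data.Vec.Properties
  using (tabulate∘lookup; tabulate-cong; lookup-zipWith; lookup-replicate; zipWith-assoc;
         zipWith-identityˡ; zipWith-identityʳ; []=⇒lookup; lookup⇒[]=)
open import Data.Product using (∃-syntax; _×_; _,_; proj₁; proj₂)
open import Data.Sum using (_⊎_; inj₁; inj₂)
open import Relation.Nullary using (¬_; Dec; yes; no; contradiction)
open import Relation.Nullary.Decidable using (¬?; _×-dec_)
open import Relation.Unary using (Pred; Decidable)
open import Relation.Binary.PropositionalEquality
open import Function.Definitions using (Injective)
open import Function using (_∘_)

lookup-ext : ∀ {A : Set} {m} {xs ys : Vec A m} → (∀ i → lookup xs i ≡ lookup ys i) → xs ≡ ys
lookup-ext {xs = xs} {ys} eq = begin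
  xs                   ≡⟨ tabulate∘lookup xs ⟨
  tabulate (lookup xs) ≡⟨ tabulate-cong eq ⟩
  tabulate (lookup ys) ≡⟨ tabulate∘lookup ys ⟩
  ys                   ∎
  where open ≡-Reasoning

module _ {m : ℕ} where

  lookup-△ : ∀ (X Y : Subset m) i → lookup (X △ Y) i ≡ lookup X i xor lookup Y i
  lookup-△ X Y i = lookup-zipWith _xor_ i X Y

  lookup-⊥ : ∀ (i : Fin m) → lookup (⊥ {m}) i ≡ false
  lookup-⊥ i = lookup-replicate i false

  lookup-⁅i⁆-self : ∀ (i : Fin m) → lookup ⁅ i ⁆ i ≡ true
  lookup-⁅i⁆-self i = []=⇒lookup (x∈⁅x⁆ i)

  lookup-⁅i⁆-≢ : ∀ {i j : Fin m} → j ≢ i → lookup ⁅ i ⁆ j ≡ false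
  lookup-⁅i⁆-≢ j≢i = ¬-not (λ j∈⁅i⁆ → x≢y⇒x∉⁅y⁆ j≢i (lookup⇒[]= _ _ j∈⁅i⁆))

  △-cancel : ∀ (X : Subset m) → X △ X ≡ ⊥
  △-cancel X = lookup-ext λ i → begin
    lookup (X △ X) i              ≡⟨ lookup-△ X X i ⟩
    lookup X i xor lookup X i     ≡⟨ xor-same (lookup X i) ⟩
    false                         ≡⟨ lookup-⊥ i ⟨
    lookup ⊥ i                    ∎
    where open ≡-Reasoning

  △-telescope : ∀ (X Y Z : Subset m) → (X △ Y) △ (Y △ Z) ≡ X △ Z
  △-telescope X Y Z = begin
    (X △ Y) △ (Y △ Z)  ≡⟨ zipWith-assoc xor-assoc X Y (Y △ Z) ⟩
    X △ (Y △ (Y △ Z))  ≡⟨ cong (X △_) (zipWith-assoc xor-assoc Y Y Z) ⟨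
    X △ ((Y △ Y) △ Z)  ≡⟨ cong (λ W → X △ (W △ Z)) (△-cancel Y) ⟩
    X △ (⊥ △ Z)        ≡⟨ cong (X △_) (zipWith-identityˡ xor-identityˡ Z) ⟩
    X △ Z              ∎
    where open ≡-Reasoning

  △≡⊥⇒≡ : ∀ {X Y : Subset m} → X △ Y ≡ ⊥ → X ≡ Y
  △≡⊥⇒≡ {X} {Y} eq = sym (begin
    Y              ≡⟨ zipWith-identityˡ xor-identityˡ Y ⟨
    ⊥ △ Y          ≡⟨ cong (_△ Y) (△-cancel X) ⟨
    (X △ X) △ Y    ≡⟨ zipWith-assoc xor-assoc X X Y ⟩
    X △ (X △ Y)    ≡⟨ cong (X △_) eq ⟩
    X △ ⊥          ≡⟨ zipWith-identityʳ xor-identityʳ X ⟩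
    X              ∎)
    where open ≡-Reasoning

isOdd : ℕ → Bool
isOdd zero    = false
isOdd (suc n) = not (isOdd n)

%2≡isOdd : ∀ n → n % 2 ≡ (if isOdd n then 1 else 0)
%2≡isOdd 0             = refl
%2≡isOdd 1             = refl
%2≡isOdd (suc (suc n)) rewrite not-involutive (isOdd n) = %2≡isOdd n

Odd⇒isOdd : ∀ n → Odd n → isOdd n ≡ true
Odd⇒isOdd n odd with isOdd n | %2≡isOdd n
... | true  | _     = refl
... | false | n%2≡0 with () ← trans (sym odd) n%2≡0

¬Odd⇒¬isOdd : ∀ n → ¬ Odd n → isOdd n ≡ false
¬Odd⇒¬isOdd n ¬odd with isOdd n | %2≡isOdd n
... | true  | n%2≡1 = contradiction n%2≡1 ¬odd
... | false | _     = refl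

Odd? : Decidable Odd
Odd? n = n % 2 ≟ 1

module _ {k p} {P : Pred (Fin k) p} (P? : Decidable P) where

  none-one-or-two : (∀ a → ¬ P a)
                  ⊎ (∃[ a ] P a × (∀ b → b ≢ a → ¬ P b))
                  ⊎ (∃[ a ] ∃[ b ] a ≢ b × P a × P b)
  none-one-or-two with Fin.any? P?
  ... | no ¬∃ = inj₁ λ a Pa → ¬∃ (a , Pa)
  ... | yes (a , Pa) with Fin.any? (λ b → ¬? (b Fin.≟ a) ×-dec P? b)
  ...   | yes (b , b≢a , Pb) = inj₂ (inj₂ (b , a , b≢a , Pb , Pa))
  ...   | no ¬∃              = inj₂ (inj₁ (a , Pa , λ b b≢a Pb → ¬∃ (b , b≢a , Pb)))

module _ {k m : ℕ} (c : Fin k → Fin m) where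

  oddToggles : List (Fin k) → Subset m
  oddToggles = foldr (λ a X → ⁅ c a ⁆ △ X) ⊥

  lookup-oddToggles-∉ : ∀ ys {e} → (∀ a → c a ≢ e) → lookup (oddToggles ys) e ≡ false
  lookup-oddToggles-∉ []       {e} _ = lookup-⊥ e
  lookup-oddToggles-∉ (y ∷ ys) {e} e∉c = trans (lookup-△ ⁅ c y ⁆ (oddToggles ys) e)
    (cong₂ _xor_ (lookup-⁅i⁆-≢ (e∉c y ∘ sym)) (lookup-oddToggles-∉ ys e∉c))

  module _ (c-injective : Injective _≡_ _≡_ c) where

    lookup-oddToggles : ∀ ys a → lookup (oddToggles ys) (c a) ≡ isOdd (count a ys)
    lookup-oddToggles []       a = lookup-⊥ (c a)
    lookup-oddToggles (y ∷ ys) a with y Fin.≟ a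
    ... | yes refl = trans (lookup-△ ⁅ c y ⁆ (oddToggles ys) (c y))
      (cong₂ _xor_ (lookup-⁅i⁆-self (c y)) (lookup-oddToggles ys y))
    ... | no  y≢a  = trans (lookup-△ ⁅ c y ⁆ (oddToggles ys) (c a))
      (cong₂ _xor_ (lookup-⁅i⁆-≢ (y≢a ∘ sym ∘ c-injective)) (lookup-oddToggles ys a))

    oddToggles-unique : ∀ ys {X : Subset m} →
                        (∀ a → lookup X (c a) ≡ isOdd (count a ys)) →
                        (∀ e → (∀ a → c a ≢ e) → lookup X e ≡ false) →
                        oddToggles ys ≡ X
    oddToggles-unique ys {X} on-c off-c =
      lookup-ext λ e → with-image e (Fin.any? (λ a → c a Fin.≟ e))
      where
      with-image : ∀ e → Dec (∃[ a ] c a ≡ e) →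
                   lookup (oddToggles ys) e ≡ lookup X e
      with-image _ (yes (a , refl)) = trans (lookup-oddToggles ys a) (sym (on-c a))
      with-image e (no e∉c)         = trans (lookup-oddToggles-∉ ys (λ a → e∉c ∘ (a ,_)))
                                            (sym (off-c e (λ a → e∉c ∘ (a ,_))))

    oddToggles-≡⊥ : ∀ ys → (∀ a → ¬ Odd (count a ys)) → oddToggles ys ≡ ⊥
    oddToggles-≡⊥ ys all-even = oddToggles-unique ys
      (λ a → trans (lookup-⊥ (c a)) (sym (¬Odd⇒¬isOdd (count a ys) (all-even a))))
      (λ e _ → lookup-⊥ e)

    oddToggles-≡⁅⁆ : ∀ ys {a} → Odd (count a ys) → (∀ b → b ≢ a → ¬ Odd (count b ys)) →
                     oddToggles ys ≡ ⁅ c a ⁆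
    oddToggles-≡⁅⁆ ys {a} odd-a others-even = oddToggles-unique ys on-c
      (λ e e∉c → lookup-⁅i⁆-≢ (e∉c a ∘ sym))
      where
      on-c : ∀ b → lookup ⁅ c a ⁆ (c b) ≡ isOdd (count b ys)
      on-c b with b Fin.≟ a
      ... | yes refl = trans (lookup-⁅i⁆-self (c a)) (sym (Odd⇒isOdd (count a ys) odd-a))
      ... | no  b≢a  = trans (lookup-⁅i⁆-≢ (b≢a ∘ c-injective))
        (sym (¬Odd⇒¬isOdd (count b ys) (others-even b b≢a)))

module _ {n k : ℕ} {col : Fin n → Fin n → Maybe (Fin k)} where

  Walk-drop : ∀ {u w vs} xs {ys} → Walk col u w vs (xs ++ ys) →
              ∃[ v ] Walk col v w (drop (length xs) vs) ys
  Walk-drop []       walk          = _ , walk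
  Walk-drop (_ ∷ xs) (cons _ walk) = Walk-drop xs walk

  Walk-take : ∀ {u w vs} xs {ys} → Walk col u w vs (xs ++ ys) →
              ∃[ v ] Walk col u v (take (suc (length xs)) vs) xs
  Walk-take []       nil           = _ , nil
  Walk-take []       (cons _ _)    = _ , nil
  Walk-take (_ ∷ xs) (cons e walk) with Walk-take xs walk
  ... | v , prefix = v , cons e prefix

  Path-infix : ∀ {u w vs} xs ys {zs} → Path col u w vs (xs ++ ys ++ zs) →
               ∃[ x ] ∃[ y ] ∃[ vs′ ] Path col x y vs′ ys
  Path-infix xs ys (walk , unique) with Walk-drop xs walk
  ... | _ , suffix with Walk-take ys suffix
  ...   | _ , segment = _ , _ , _ , segment , take⁺ _ (drop⁺ (length xs) unique)

  Walk-end∈ : ∀ {u w vs as} → Walk col u w vs as → w ∈ vs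
  Walk-end∈ nil           = here refl
  Walk-end∈ (cons _ walk) = there (Walk-end∈ walk)

  Path-ends-≢ : ∀ {u w vs as} → Path col u w vs as → 1 ≤ length as → u ≢ w
  Path-ends-≢ (cons _ walk , u∉vs ∷ _) _ = All.lookup u∉vs (Walk-end∈ walk)

HasTwoOddLetters : ∀ {k} → List (Fin k) → Set
HasTwoOddLetters ys = ∃[ a ] ∃[ b ] a ≢ b × Odd (count a ys) × Odd (count b ys)

module _ {n k m : ℕ} {col : Fin n → Fin n → Maybe (Fin k)}
         {φ : Fin n → Subset m} {c : Fin k → Fin m} where

  Walk-△ : (∀ {u v a} → col u v ≡ just a → φ u △ φ v ≡ ⁅ c a ⁆) →
           ∀ {x y vs ys} → Walk col x y vs ys → φ x △ φ y ≡ oddToggles c ys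
  Walk-△ _      {x} nil = △-cancel (φ x)
  Walk-△ edge⇒△ {x} {y} (cons {v = v} {as = as} {a = a} e walk) = begin
    φ x △ φ y                        ≡⟨ △-telescope (φ x) (φ v) (φ y) ⟨
    (φ x △ φ v) △ (φ v △ φ y)        ≡⟨ cong₂ _△_ (edge⇒△ e) (Walk-△ edge⇒△ walk) ⟩
    ⁅ c a ⁆ △ oddToggles c as        ∎
    where open ≡-Reasoning

  module _ (symmetric : ∀ u v → col u v ≡ col v u)
           (loopless : ∀ v → col v v ≡ nothing)
           (acyclic : Acyclic col)
           (φ-injective : Injective _≡_ _≡_ φ)
           (c-injective : Injective _≡_ _≡_ c)
           (labels : ∀ u v a → u ≢ v →
                     (col u v ≡ just a → φ u △ φ v ≡ ⁅ c a ⁆)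
                     × (φ u △ φ v ≡ ⁅ c a ⁆ → col u v ≡ just a)) where

    edge⇒△ : ∀ {u v a} → col u v ≡ just a → φ u △ φ v ≡ ⁅ c a ⁆
    edge⇒△ {u} {v} {a} e = proj₁ (labels u v a u≢v) e
      where
      u≢v : u ≢ v
      u≢v refl with () ← trans (sym e) (loopless u)

    Walk-allEven⇒closed : ∀ {x y vs ys} → Walk col x y vs ys →
                          (∀ a → ¬ Odd (count a ys)) → x ≡ y
    Walk-allEven⇒closed {x} {y} {ys = ys} walk all-even = φ-injective (△≡⊥⇒≡ (begin
      φ x △ φ y        ≡⟨ Walk-△ edge⇒△ walk ⟩
      oddToggles c ys  ≡⟨ oddToggles-≡⊥ c c-injective ys all-even ⟩
      ⊥                ∎))
      where open ≡-Reasoning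

    Walk-oneOdd⇒edge : ∀ {x y vs ys a} → Walk col x y vs ys → x ≢ y →
                       Odd (count a ys) → (∀ b → b ≢ a → ¬ Odd (count b ys)) →
                       col x y ≡ just a
    Walk-oneOdd⇒edge {x} {y} {ys = ys} {a} walk x≢y odd-a others-even =
      proj₂ (labels x y a x≢y) (begin
        φ x △ φ y        ≡⟨ Walk-△ edge⇒△ walk ⟩
        oddToggles c ys  ≡⟨ oddToggles-≡⁅⁆ c c-injective ys odd-a others-even ⟩
        ⁅ c a ⁆          ∎)
      where open ≡-Reasoning

    Path-hasTwoOddLetters : ∀ {x y vs ys} → Path col x y vs ys → 2 ≤ length ys →
                            HasTwoOddLetters ys
    Path-hasTwoOddLetters {x} {y} {vs} {ys} path@(walk , _) 2≤len
      with none-one-or-two (λ a → Odd? (count a ys))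
    ... | inj₁ all-even =
      contradiction (Walk-allEven⇒closed walk all-even) (Path-ends-≢ path (<⇒≤ 2≤len))
    ... | inj₂ (inj₁ (a , odd-a , others-even)) =
      contradiction (trans (symmetric y x) edge) (acyclic x y vs ys a path 2≤len)
      where
      edge : col x y ≡ just a
      edge = Walk-oneOdd⇒edge walk (Path-ends-≢ path (<⇒≤ 2≤len)) odd-a others-even
    ... | inj₂ (inj₂ two) = two

theorem4p2 : (n k : ℕ) (col : Fin n → Fin n → Maybe (Fin k)) →
    IsTree col → IsProperEdgeColoring col → IsGeneralizedToggleGroup col →
    ∀ (u v : Fin n) (vs : List (Fin n)) (w : List (Fin k)) →
    Path col u v vs w → 2 ≤ length w → IsToggleWord w
theorem4p2 n k col ((symmetric , loopless) , _ , acyclic) _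
           (m , φ , c , φ-injective , c-injective , labels , _) u v vs w path 2≤len =
  2≤len , λ xs ys zs w≡xs++ys++zs 2≤len-ys →
    let (_ , _ , _ , segment) = Path-infix xs ys (subst (Path col u v vs) w≡xs++ys++zs path)
    in Path-hasTwoOddLetters symmetric loopless acyclic φ-injective c-injective labels
         segment 2≤len-ys
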